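{- The set $T_I=\{t_B: B\subseteq\{l,r\}^\star\text{ and }B\text{ has no infinite antichain}\}$ is a regular tree language.
   Context: An antichain is a set of words in $\{l,r\}^\star$ pairwise incomparable for the prefix order. For $B\subseteq\{l,r\}^\star$, $t_B:\{l,r\}^\star\to\{0,1\}$ is the infinite binary tree with $t_B(u)=1$ iff $u\in B$. A tree language $L\subseteq T^\omega_\Sigma$ is regular if it is the set of trees accepted by a Muller tree automaton $(Q,\Sigma,\Delta,q_0,\mathcal{F})$ ($Q$ finite, $\Delta\subseteq Q\times\Sigma\times Q\times Q$, $\mathcal{F}\subseteq 2^Q$), where $t$ is accepted if there is $\rho:\{l,r\}^\star\to Q$ with $\rho(\varepsilon)=q_0$, $(\rho(u),t(u),\rho(ul),\rho(ur))\in\Delta$ for all $u$, such that on every infinite branch the set of states occurring infinitely often belongs to $\mathcal{F}$. -}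

module Defs where

open import Data.Nat using (ℕ; zero; suc; _≤_)
open import Data.Bool using (Bool; true; false)
open import Data.Fin using (Fin)
open import Data.Fin.Subset using (Subset; _∈_)
open import Data.List using (List; []; _∷_; _++_; [_])
open import Data.List.Membership.Propositional renaming (_∈_ to _∈ₗ_)
open import Data.Product using (Σ; ∃; _×_; _,_)
open import Relation.Binary.PropositionalEquality using (_≡_; _≢_)
open import Relation.Nullary using (¬_)
open import Function.Bundles using (_⇔_)

data Dir : Set where
  l r : Dir

Word : Set
Word = List Dir

_≼_ : Word → Word → Set
u ≼ v = ∃ λ w → u ++ w ≡ v

Incomparable : Word → Word → Set
Incomparable u v = ¬ (u ≼ v) × ¬ (v ≼ u)

InfiniteAntichainIn : (Word → Set) → Set
InfiniteAntichainIn B =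
  Σ (ℕ → Word) λ f → (∀ i → B (f i)) × (∀ i j → i ≢ j → Incomparable (f i) (f j))

Tree : Set → Set
Tree A = Word → A

-- t_B for B ⊆ {l,r}* (B given as a predicate)
-- we identify a {0,1}-tree t with the set B = t⁻¹(1) (t = t_B)
NodesOne : Tree Bool → Word → Set
NodesOne t u = t u ≡ true

T-I : Tree Bool → Set
T-I t = ¬ InfiniteAntichainIn (NodesOne t)

record Muller (A : Set) : Set where
  field
    n  : ℕ
    Δ  : Fin n → A → Fin n → Fin n → Bool   -- characteristic function of Δ ⊆ Q×A×Q×Q
    q₀ : Fin n
    𝓕  : List (Subset n)

prefix : (ℕ → Dir) → ℕ → Word
prefix π zero    = []
prefix π (suc m) = prefix π m ++ [ π m ]

InfOften : {n : ℕ} → (Word → Fin n) → (ℕ → Dir) → Fin n → Set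
InfOften ρ π q = ∀ N → ∃ λ m → N ≤ m × ρ (prefix π m) ≡ q

IsInfSet : {n : ℕ} → (Word → Fin n) → (ℕ → Dir) → Subset n → Set
IsInfSet ρ π S = ∀ q → (q ∈ S) ⇔ InfOften ρ π q

module _ {A : Set} (M : Muller A) where
  open Muller M

  IsRun : Tree A → (Word → Fin n) → Set
  IsRun t ρ = ρ [] ≡ q₀ × (∀ u → Δ (ρ u) (t u) (ρ (u ++ [ l ])) (ρ (u ++ [ r ])) ≡ true)

  AcceptingRun : (Word → Fin n) → Set
  AcceptingRun ρ = ∀ (π : ℕ → Dir) → ∃ λ S → S ∈ₗ 𝓕 × IsInfSet ρ π S

  Accepts : Tree A → Set
  Accepts t = ∃ λ ρ → IsRun t ρ × AcceptingRun ρ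

Regular : {A : Set} → (Tree A → Set) → Set
Regular {A} L = Σ (Muller A) λ M → ∀ t → L t ⇔ Accepts M t

module Submission where

-- The k-th off-branch subtree of a branch π is the one
-- leaving π at depth k.  B has an infinite antichain iff some branch has
-- infinitely many off-branch subtrees containing a 1 (offBranch-antichain,
-- antichain-offBranch): 1s in distinct off-branch subtrees are incomparable;
-- conversely, Kőnig descent through nodes above infinitely many antichain
-- elements gives a branch π, and if almost all its off-branch subtrees were
-- empty, the antichain elements deep enough would lie on π, hence comparable.
--
-- A state (e , m) guesses "a 1 occurs in my subtree" (e) and "a 1
-- occurs in my sibling's subtree" (m, a mark); transitions check that e = false
-- is right and that each child's mark is its sibling's e; acceptance forbids
-- marks infinitely often on a branch (accepting⇔).  Every run marks π
-- infinitely often when π has infinitely many nonempty off-branch subtrees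
-- (RunSoundness), and the truthful run (TruthfulRun) only then.

open import Defs
open import Axiom.ExcludedMiddle using (ExcludedMiddle)
open import Level using (0ℓ)
open import Data.Bool using (Bool; true; false)
open import Data.Bool.Properties using (¬-not) renaming (_≟_ to _≟ᵇ_)
open import Data.Nat using (ℕ; zero; suc; _≤_; _<_; _≤′_; ≤′-refl; ≤′-step; s≤s; _⊔_)
open import Data.Nat.Properties using (≤-refl; ≤-trans; n≤1+n; <-trans; <⇒≤; <⇒≢; ≤⇒≤′; ≤-total; <-cmp; m≤m⊔n; m≤n⊔m; m≤n⇒m<n∨m≡n)
open import Data.Fin using (Fin) renaming (zero to 0F; suc to sucF)
open import Data.Fin.Subset using (Subset; _∈_)
open import Data.Vec using (_∷_; []; tabulate; lookup)
open import Data.Vec.Properties using (lookup∘tabulate; []=⇒lookup; lookup⇒[]=)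
open import Data.List using (List; []; _∷_; _++_; [_])
open import Data.List.Properties using (++-assoc; ++-identityʳ; ++-cancelˡ; ∷-injectiveˡ)
open import Data.List.Membership.Propositional renaming (_∈_ to _∈ₗ_)
open import Data.List.Relation.Unary.Any using (here; there)
open import Data.Product using (Σ; ∃; ∃₂; _×_; _,_; proj₁; proj₂)
open import Data.Sum using (_⊎_; inj₁; inj₂)
open import Data.Empty using (⊥; ⊥-elim)
open import Relation.Nullary using (¬_; Dec; yes; no; does)
open import Relation.Nullary.Decidable using (dec-true; dec-false; _×-dec_; _→-dec_)
open import Relation.Binary.PropositionalEquality using (_≡_; _≢_; refl; sym; trans; cong; subst; subst₂; module ≡-Reasoning)
open import Relation.Binary.Definitions using (tri<; tri≈; tri>)
open import Function.Bundles using (_⇔_; mk⇔; Equivalence)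

EM : Set₁
EM = ExcludedMiddle 0ℓ

dec-sound : {A : Set} (a? : Dec A) → does a? ≡ true → A
dec-sound (yes a) _ = a
dec-sound (no _) ()

dec-refute : {A : Set} (a? : Dec A) → does a? ≡ false → ¬ A
dec-refute (yes _) ()
dec-refute (no ¬a) _ = ¬a

true≢false : true ≢ false
true≢false ()

InfinitelyOften : (ℕ → Set) → Set
InfinitelyOften P = ∀ N → ∃ λ m → N ≤ m × P m

infinitelyOften-map : {P Q : ℕ → Set} → (∀ m → P m → Q m) →
                      InfinitelyOften P → InfinitelyOften Q
infinitelyOften-map f io N =
  let (m , N≤m , p) = io N in m , N≤m , f m p

-- Infinite pigeonhole for two colours (classical: it decides whether P is
-- eventually false).
infinitelyOften-⊎ : EM → {P Q : ℕ → Set} →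
  InfinitelyOften (λ m → P m ⊎ Q m) → InfinitelyOften P ⊎ InfinitelyOften Q
infinitelyOften-⊎ em {P} {Q} io with em {InfinitelyOften P}
... | yes ioP = inj₁ ioP
... | no ¬ioP = inj₂ ioQ
  where
  ioQ : InfinitelyOften Q
  ioQ N with em {∃ λ m → N ≤ m × Q m}
  ... | yes q = q
  ... | no ¬q = ⊥-elim (¬ioP λ N′ → onlyP N′ (io (N ⊔ N′)))
    where
    -- beyond N, Q never holds, so the witnesses of P ∪ Q witness P
    onlyP : ∀ N′ → (∃ λ m → N ⊔ N′ ≤ m × (P m ⊎ Q m)) → ∃ λ m → N′ ≤ m × P m
    onlyP N′ (m , le , inj₁ p) = m , ≤-trans (m≤n⊔m N N′) le , p
    onlyP N′ (m , le , inj₂ q) = ⊥-elim (¬q (m , ≤-trans (m≤m⊔n N N′) le , q))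

opposite : Dir → Dir
opposite l = r
opposite r = l

opposite-≢ : ∀ d → opposite d ≢ d
opposite-≢ l ()
opposite-≢ r ()

same-or-opposite : ∀ d e → d ≡ e ⊎ d ≡ opposite e
same-or-opposite l l = inj₁ refl
same-or-opposite l r = inj₂ refl
same-or-opposite r l = inj₂ refl
same-or-opposite r r = inj₁ refl

incomparable-sym : ∀ {u v} → Incomparable u v → Incomparable v u
incomparable-sym (u⋠v , v⋠u) = v⋠u , u⋠v

diverging-incomparable : ∀ p {d e} x y → d ≢ e → Incomparable (p ++ d ∷ x) (p ++ e ∷ y)
diverging-incomparable p x y d≢e =
  not-prefix x y d≢e , not-prefix y x (λ e≡d → d≢e (sym e≡d))
  where
  not-prefix : ∀ {d e} x y → d ≢ e → ¬ ((p ++ d ∷ x) ≼ (p ++ e ∷ y))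
  not-prefix {d} x y d≢e (z , eq) =
    d≢e (∷-injectiveˡ (++-cancelˡ p _ _ (trans (sym (++-assoc p (d ∷ x) z)) eq)))

prefix-or-child : ∀ {u v} → u ≼ v → u ≡ v ⊎ ∃ λ d → (u ++ [ d ]) ≼ v
prefix-or-child {u} ([] , eq) = inj₁ (trans (sym (++-identityʳ u)) eq)
prefix-or-child {u} (d ∷ w , eq) = inj₂ (d , w , trans (++-assoc u [ d ] w) eq)

prefix-mono : ∀ π {a b} → a ≤ b → prefix π a ≼ prefix π b
prefix-mono π {a} a≤b = go (≤⇒≤′ a≤b)
  where
  go : ∀ {b} → a ≤′ b → prefix π a ≼ prefix π b
  go ≤′-refl = [] , ++-identityʳ _
  go (≤′-step {b} h) =
    let (w , eq) = go h
    in w ++ [ π b ] , trans (sym (++-assoc (prefix π a) w [ π b ])) (cong (_++ [ π b ]) eq)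

prefixes-comparable : ∀ π a b → prefix π a ≼ prefix π b ⊎ prefix π b ≼ prefix π a
prefixes-comparable π a b with ≤-total a b
... | inj₁ a≤b = inj₁ (prefix-mono π a≤b)
... | inj₂ b≤a = inj₂ (prefix-mono π b≤a)

Occurs : Tree Bool → Word → Set
Occurs t v = ∃ λ w → t (v ++ w) ≡ true

offBranch : (ℕ → Dir) → ℕ → Word
offBranch π k = prefix π k ++ [ opposite (π k) ]

Off : Tree Bool → (ℕ → Dir) → ℕ → Set
Off t π k = Occurs t (offBranch π k)

-- Nodes in off-branch subtrees at different depths are incomparable: they
-- diverge right after the shallower depth.
offBranches-incomparable : ∀ π {a b} x y → a < b →
  Incomparable (offBranch π a ++ x) (offBranch π b ++ y)
offBranches-incomparable π {a} {b} x y a<b =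
  subst (λ v → Incomparable v (offBranch π b ++ y)) (sym (++-assoc (prefix π a) _ x))
    (subst (Incomparable (prefix π a ++ opposite (π a) ∷ x)) (sym deeper)
      (diverging-incomparable (prefix π a) x (z ++ offTail) (opposite-≢ (π a))))
  where
  below : prefix π (suc a) ≼ prefix π b
  below = prefix-mono π a<b
  z : Word
  z = proj₁ below
  offTail : Word
  offTail = opposite (π b) ∷ y
  deeper : offBranch π b ++ y ≡ prefix π a ++ π a ∷ (z ++ offTail)
  deeper = begin
    (prefix π b ++ [ opposite (π b) ]) ++ y  ≡⟨ ++-assoc (prefix π b) _ y ⟩
    prefix π b ++ offTail                    ≡⟨ cong (_++ offTail) (sym (proj₂ below)) ⟩
    (prefix π (suc a) ++ z) ++ offTail       ≡⟨ ++-assoc (prefix π (suc a)) z offTail ⟩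
    (prefix π a ++ [ π a ]) ++ z ++ offTail  ≡⟨ ++-assoc (prefix π a) [ π a ] _ ⟩
    prefix π a ++ π a ∷ (z ++ offTail)       ∎
    where open ≡-Reasoning

offBranch-antichain : ∀ t π → InfinitelyOften (Off t π) → InfiniteAntichainIn (NodesOne t)
offBranch-antichain t π io = f , (λ i → proj₂ (off i)) , f-incomparable
  where
  depth : ℕ → ℕ
  depth zero = proj₁ (io 0)
  depth (suc i) = proj₁ (io (suc (depth i)))
  off : ∀ i → Off t π (depth i)
  off zero = proj₂ (proj₂ (io 0))
  off (suc i) = proj₂ (proj₂ (io (suc (depth i))))
  depth-step : ∀ i → depth i < depth (suc i)
  depth-step i = proj₁ (proj₂ (io (suc (depth i))))
  depth-increasing : ∀ {i j} → i < j → depth i < depth j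
  depth-increasing {i} {suc j} (s≤s i≤j) with m≤n⇒m<n∨m≡n i≤j
  ... | inj₁ i<j = <-trans (depth-increasing i<j) (depth-step j)
  ... | inj₂ refl = depth-step i
  f : ℕ → Word
  f i = offBranch π (depth i) ++ proj₁ (off i)
  f-incomparable : ∀ i j → i ≢ j → Incomparable (f i) (f j)
  f-incomparable i j i≢j with <-cmp i j
  ... | tri< i<j _ _ = offBranches-incomparable π _ _ (depth-increasing i<j)
  ... | tri≈ _ i≡j _ = ⊥-elim (i≢j i≡j)
  ... | tri> _ _ j<i = incomparable-sym (offBranches-incomparable π _ _ (depth-increasing j<i))

ones-on-branch : ∀ t π k → (∀ j → k ≤ j → ¬ Off t π j) →
  ∀ s → t (prefix π k ++ s) ≡ true → ∃ λ a → prefix π k ++ s ≡ prefix π a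
ones-on-branch t π k noOff [] _ = k , ++-identityʳ _
ones-on-branch t π k noOff (d ∷ s) one with same-or-opposite d (π k)
... | inj₁ refl =
  let (a , eq) = ones-on-branch t π (suc k) (λ j sk≤j → noOff j (<⇒≤ sk≤j)) s
                   (subst (λ v → t v ≡ true) (sym (++-assoc (prefix π k) [ d ] s)) one)
  in a , trans (sym (++-assoc (prefix π k) [ d ] s)) eq
... | inj₂ refl =
  ⊥-elim (noOff k ≤-refl (s , subst (λ v → t v ≡ true) (sym (++-assoc (prefix π k) [ d ] s)) one))

descend : (P : Word → Set) → P [] → (∀ u → P u → ∃ λ d → P (u ++ [ d ])) →
          ∃ λ (π : ℕ → Dir) → ∀ m → P (prefix π m)
descend P p[] child = π , λ m → subst P (sym (prefix-walk m)) (proj₂ (walk m))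
  where
  walk : ℕ → Σ Word P
  walk zero = [] , p[]
  walk (suc m) = proj₁ (walk m) ++ [ proj₁ (child _ (proj₂ (walk m))) ] , proj₂ (child _ (proj₂ (walk m)))
  π : ℕ → Dir
  π m = proj₁ (child _ (proj₂ (walk m)))
  prefix-walk : ∀ m → prefix π m ≡ proj₁ (walk m)
  prefix-walk zero = refl
  prefix-walk (suc m) = cong (_++ [ π m ]) (prefix-walk m)

antichain-offBranch : EM → ∀ t → InfiniteAntichainIn (NodesOne t) →
                      ∃ λ π → InfinitelyOften (Off t π)
antichain-offBranch em t (f , f∈t , f-inc) = π , off-often
  where
  Heavy : Word → Set
  Heavy u = InfinitelyOften (λ i → u ≼ f i)

  -- at most one antichain element equals u, the others lie below a child
  below-children : ∀ u → Heavy u →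
    InfinitelyOften (λ i → (u ++ [ l ]) ≼ f i ⊎ (u ++ [ r ]) ≼ f i)
  below-children u heavy N with heavy N
  ... | i , N≤i , u≼fi with prefix-or-child u≼fi
  ...   | inj₂ (l , below) = i , N≤i , inj₁ below
  ...   | inj₂ (r , below) = i , N≤i , inj₂ below
  ...   | inj₁ u≡fi with heavy (suc i)
  ...     | j , i<j , u≼fj with prefix-or-child u≼fj
  ...       | inj₂ (l , below) = j , ≤-trans N≤i (<⇒≤ i<j) , inj₁ below
  ...       | inj₂ (r , below) = j , ≤-trans N≤i (<⇒≤ i<j) , inj₂ below
  ...       | inj₁ u≡fj = ⊥-elim (proj₁ (f-inc i j (<⇒≢ i<j))
                            ([] , trans (++-identityʳ (f i)) (trans (sym u≡fi) u≡fj)))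

  -- by pigeonhole, one child of a heavy node is heavy
  heavy-child : ∀ u → Heavy u → ∃ λ d → Heavy (u ++ [ d ])
  heavy-child u heavy with infinitelyOften-⊎ em (below-children u heavy)
  ... | inj₁ heavyˡ = l , heavyˡ
  ... | inj₂ heavyʳ = r , heavyʳ

  -- the root is heavy, so Kőnig descent gives a branch of heavy nodes
  heavyBranch : ∃ λ (π : ℕ → Dir) → ∀ m → Heavy (prefix π m)
  heavyBranch = descend Heavy (λ N → N , ≤-refl , f N , refl) heavy-child

  π : ℕ → Dir
  π = proj₁ heavyBranch

  not-both-on : ∀ {i j} → i ≢ j → ∀ a b → f i ≡ prefix π a → f j ≡ prefix π b → ⊥
  not-both-on {i} {j} i≢j a b eᵢ eⱼ with prefixes-comparable π a b
  ... | inj₁ a≼b = proj₁ (f-inc i j i≢j) (subst₂ _≼_ (sym eᵢ) (sym eⱼ) a≼b)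
  ... | inj₂ b≼a = proj₂ (f-inc i j i≢j) (subst₂ _≼_ (sym eⱼ) (sym eᵢ) b≼a)

  on-branch : ∀ N → (∀ k → N ≤ k → ¬ Off t π k) → ∀ i → prefix π N ≼ f i →
              ∃ λ a → f i ≡ prefix π a
  on-branch N noOff i (s , eq) =
    let (a , e) = ones-on-branch t π N noOff s (subst (λ v → t v ≡ true) (sym eq) (f∈t i))
    in a , trans (sym eq) e

  -- otherwise two antichain elements below prefix π N would lie on π
  off-often : InfinitelyOften (Off t π)
  off-often N with em {∃ λ k → N ≤ k × Off t π k}
  ... | yes off = off
  ... | no ¬off =
    let noOff : ∀ k → N ≤ k → ¬ Off t π k
        noOff k N≤k off = ¬off (k , N≤k , off)
        (i , _ , i-below) = proj₂ heavyBranch N 0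
        (j , i<j , j-below) = proj₂ heavyBranch N (suc i)
        (a , eᵢ) = on-branch N noOff i i-below
        (b , eⱼ) = on-branch N noOff j j-below
    in ⊥-elim (not-both-on (<⇒≢ i<j) a b eᵢ eⱼ)

-- States (e , m) coded in Fin 4: e guesses "a 1 occurs in my subtree",
-- m (the mark) guesses "a 1 occurs in my sibling's subtree".
state : Bool → Bool → Fin 4
state false false = 0F
state true  false = sucF 0F
state false true  = sucF (sucF 0F)
state true  true  = sucF (sucF (sucF 0F))

nonempty : Fin 4 → Bool
nonempty 0F = false
nonempty (sucF 0F) = true
nonempty (sucF (sucF 0F)) = false
nonempty (sucF (sucF (sucF 0F))) = true

marked : Fin 4 → Bool
marked 0F = false
marked (sucF 0F) = false
marked (sucF (sucF _)) = true

nonempty-state : ∀ e m → nonempty (state e m) ≡ e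
nonempty-state false false = refl
nonempty-state true  false = refl
nonempty-state false true  = refl
nonempty-state true  true  = refl

marked-state : ∀ e m → marked (state e m) ≡ m
marked-state false false = refl
marked-state true  false = refl
marked-state false true  = refl
marked-state true  true  = refl

Step : Fin 4 → Bool → Fin 4 → Fin 4 → Set
Step q a q₁ q₂ =
  (nonempty q ≡ false → a ≡ false × nonempty q₁ ≡ false × nonempty q₂ ≡ false)
  × marked q₁ ≡ nonempty q₂ × marked q₂ ≡ nonempty q₁

step? : ∀ q a q₁ q₂ → Dec (Step q a q₁ q₂)
step? q a q₁ q₂ =
  (nonempty q ≟ᵇ false →-dec a ≟ᵇ false ×-dec nonempty q₁ ≟ᵇ false ×-dec nonempty q₂ ≟ᵇ false)
  ×-dec marked q₁ ≟ᵇ nonempty q₂ ×-dec marked q₂ ≟ᵇ nonempty q₁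

unmarkedSubset : Bool → Bool → Subset 4
unmarkedSubset a b = a ∷ b ∷ false ∷ false ∷ []

unmarkedSets : List (Subset 4)
unmarkedSets = unmarkedSubset false false ∷ unmarkedSubset false true
             ∷ unmarkedSubset true false ∷ unmarkedSubset true true ∷ []

unmarkedSubset-listed : ∀ a b → unmarkedSubset a b ∈ₗ unmarkedSets
unmarkedSubset-listed false false = here refl
unmarkedSubset-listed false true  = there (here refl)
unmarkedSubset-listed true  false = there (there (here refl))
unmarkedSubset-listed true  true  = there (there (there (here refl)))

unmarkedSets-shape : ∀ {S} → S ∈ₗ unmarkedSets → ∃₂ λ a b → S ≡ unmarkedSubset a b
unmarkedSets-shape (here refl) = _ , _ , refl
unmarkedSets-shape (there (here refl)) = _ , _ , refl
unmarkedSets-shape (there (there (here refl))) = _ , _ , refl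
unmarkedSets-shape (there (there (there (here refl)))) = _ , _ , refl

unmarkedSets-avoid-marks : ∀ {S} → S ∈ₗ unmarkedSets → ∀ q → marked q ≡ true → lookup S q ≡ false
unmarkedSets-avoid-marks S∈ q mq with unmarkedSets-shape S∈
unmarkedSets-avoid-marks S∈ (sucF (sucF 0F)) mq | _ , _ , refl = refl
unmarkedSets-avoid-marks S∈ (sucF (sucF (sucF 0F))) mq | _ , _ , refl = refl

unmarked-listed : ∀ S → (∀ q → marked q ≡ true → lookup S q ≡ false) → S ∈ₗ unmarkedSets
unmarked-listed (a ∷ b ∷ _ ∷ _ ∷ []) avoids
  with avoids (sucF (sucF 0F)) refl | avoids (sucF (sucF (sucF 0F))) refl
... | refl | refl = unmarkedSubset-listed a b

-- The automaton: the root starts in (true , false), which imposes nothing.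
M : Muller Bool
M = record
  { n  = 4
  ; Δ  = λ q a q₁ q₂ → does (step? q a q₁ q₂)
  ; q₀ = state true false
  ; 𝓕  = unmarkedSets
  }

recurring-states : EM → ∀ {n} (ρ : Word → Fin n) π → ∃ λ S → IsInfSet ρ π S
recurring-states em ρ π = S , λ q → mk⇔ (recurs q) (listed q)
  where
  recurs? : ∀ q → Bool
  recurs? q = does (em {InfOften ρ π q})
  S : Subset _
  S = tabulate recurs?
  recurs : ∀ q → q ∈ S → InfOften ρ π q
  recurs q q∈S = dec-sound em (trans (sym (lookup∘tabulate recurs? q)) ([]=⇒lookup q∈S))
  listed : ∀ q → InfOften ρ π q → q ∈ S
  listed q io = lookup⇒[]= q S (trans (lookup∘tabulate recurs? q) (dec-true em io))

MarkedOften : (Word → Fin 4) → (ℕ → Dir) → Set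
MarkedOften ρ π = InfinitelyOften (λ m → marked (ρ (prefix π m)) ≡ true)

marked-cases : ∀ q → marked q ≡ true → q ≡ state false true ⊎ q ≡ state true true
marked-cases (sucF (sucF 0F)) _ = inj₁ refl
marked-cases (sucF (sucF (sucF 0F))) _ = inj₂ refl

marked-state-recurs : EM → ∀ ρ π → MarkedOften ρ π →
                      ∃ λ q → marked q ≡ true × InfOften ρ π q
marked-state-recurs em ρ π often
  with infinitelyOften-⊎ em (infinitelyOften-map (λ m → marked-cases (ρ (prefix π m))) often)
... | inj₁ io = state false true , refl , io
... | inj₂ io = state true true , refl , io

accepting⇔ : EM → ∀ ρ → AcceptingRun M ρ ⇔ (∀ π → ¬ MarkedOften ρ π)
accepting⇔ em ρ = mk⇔ unmarked accepting
  where
  unmarked : AcceptingRun M ρ → ∀ π → ¬ MarkedOften ρ π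
  unmarked acc π often =
    let (q , mq , io) = marked-state-recurs em ρ π often
        (S , S∈ , isInf) = acc π
        q∈S = Equivalence.from (isInf q) io
    in true≢false (trans (sym ([]=⇒lookup q∈S)) (unmarkedSets-avoid-marks S∈ q mq))
  accepting : (∀ π → ¬ MarkedOften ρ π) → AcceptingRun M ρ
  accepting never π =
    let (S , isInf) = recurring-states em ρ π
        avoids : ∀ q → marked q ≡ true → lookup S q ≡ false
        avoids q mq = ¬-not λ q∈S → never π (infinitelyOften-map
                        (λ m eq → trans (cong marked eq) mq)
                        (Equivalence.to (isInf q) (lookup⇒[]= q S q∈S)))
    in S , unmarked-listed S avoids , isInf

-- Any run of M guesses soundly: a guess "empty" is right, so a node is
-- marked whenever its sibling's subtree contains a 1.
module RunSoundness {t : Tree Bool} {ρ : Word → Fin 4} (run : IsRun M t ρ) where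

  step-at : ∀ u → Step (ρ u) (t u) (ρ (u ++ [ l ])) (ρ (u ++ [ r ]))
  step-at u = dec-sound (step? _ _ _ _) (proj₂ run u)

  empty-child : ∀ v d → nonempty (ρ v) ≡ false → nonempty (ρ (v ++ [ d ])) ≡ false
  empty-child v l e = proj₁ (proj₂ (proj₁ (step-at v) e))
  empty-child v r e = proj₂ (proj₂ (proj₁ (step-at v) e))

  empty-sound : ∀ v w → nonempty (ρ v) ≡ false → t (v ++ w) ≡ false
  empty-sound v [] e = trans (cong t (++-identityʳ v)) (proj₁ (proj₁ (step-at v) e))
  empty-sound v (d ∷ w) e =
    trans (cong t (sym (++-assoc v [ d ] w))) (empty-sound (v ++ [ d ]) w (empty-child v d e))

  mark-is-sibling-guess : ∀ u d → marked (ρ (u ++ [ d ])) ≡ nonempty (ρ (u ++ [ opposite d ]))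
  mark-is-sibling-guess u l = proj₁ (proj₂ (step-at u))
  mark-is-sibling-guess u r = proj₂ (proj₂ (step-at u))

  mark-complete : ∀ u d → Occurs t (u ++ [ opposite d ]) → marked (ρ (u ++ [ d ])) ≡ true
  mark-complete u d (w , one) =
    trans (mark-is-sibling-guess u d) (¬-not λ empty → true≢false (trans (sym one) (empty-sound _ w empty)))

accepted⇒no-antichain : EM → ∀ t → Accepts M t → T-I t
accepted⇒no-antichain em t (ρ , run , acc) antichain =
  Equivalence.to (accepting⇔ em ρ) acc π marks-recur
  where
  open RunSoundness {t} {ρ} run
  π : ℕ → Dir
  π = proj₁ (antichain-offBranch em t antichain)
  -- a nonempty k-th off-branch subtree marks the node at depth k + 1
  marks-recur : MarkedOften ρ π
  marks-recur N =
    let (k , N≤k , off) = proj₂ (antichain-offBranch em t antichain) N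
    in suc k , ≤-trans N≤k (n≤1+n k) , mark-complete (prefix π k) (π k) off

-- The truthful run: every guess is correct (decided by excluded middle).
module TruthfulRun (em : EM) (t : Tree Bool) where

  occurs? : Word → Bool
  occurs? v = does (em {Occurs t v})

  -- x ∷ xs with its last letter flipped
  sibling : Dir → Word → Word
  sibling x [] = [ opposite x ]
  sibling x (y ∷ ys) = x ∷ sibling y ys

  sibling-snoc : ∀ x u d → sibling x (u ++ [ d ]) ≡ x ∷ (u ++ [ opposite d ])
  sibling-snoc x [] d = refl
  sibling-snoc x (y ∷ u) d = cong (x ∷_) (sibling-snoc y u d)

  ρ : Word → Fin 4
  ρ [] = state true false
  ρ (x ∷ xs) = state (occurs? (x ∷ xs)) (occurs? (sibling x xs))

  ρ-child : ∀ u d → ρ (u ++ [ d ]) ≡ state (occurs? (u ++ [ d ])) (occurs? (u ++ [ opposite d ]))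
  ρ-child [] d = refl
  ρ-child (x ∷ u) d = cong (state (occurs? (x ∷ u ++ [ d ]))) (cong occurs? (sibling-snoc x u d))

  nonempty-child : ∀ u d → nonempty (ρ (u ++ [ d ])) ≡ occurs? (u ++ [ d ])
  nonempty-child u d = trans (cong nonempty (ρ-child u d)) (nonempty-state _ _)

  marked-child : ∀ u d → marked (ρ (u ++ [ d ])) ≡ occurs? (u ++ [ opposite d ])
  marked-child u d = trans (cong marked (ρ-child u d)) (marked-state _ _)

  empty-correct : ∀ u → nonempty (ρ u) ≡ false → ¬ Occurs t u
  empty-correct [] ()
  empty-correct (x ∷ xs) e = dec-refute em (trans (sym (nonempty-state _ _)) e)

  empty-below : ∀ u → ¬ Occurs t u → t u ≡ false × ∀ d → occurs? (u ++ [ d ]) ≡ false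
  empty-below u none =
      ¬-not (λ one → none ([] , trans (cong t (++-identityʳ u)) one))
    , λ d → dec-false em λ (w , one) → none (d ∷ w , trans (cong t (sym (++-assoc u [ d ] w))) one)

  run : IsRun M t ρ
  run = refl , λ u → dec-true (step? _ _ _ _) (step u)
    where
    step : ∀ u → Step (ρ u) (t u) (ρ (u ++ [ l ])) (ρ (u ++ [ r ]))
    step u = (λ e → let (t≡ , children) = empty-below u (empty-correct u e)
                    in t≡ , trans (nonempty-child u l) (children l) , trans (nonempty-child u r) (children r))
           , trans (marked-child u l) (sym (nonempty-child u r))
           , trans (marked-child u r) (sym (nonempty-child u l))

  -- a mark at depth k + 1 on π reveals a 1 in the k-th off-branch subtree
  marks-off : ∀ π → MarkedOften ρ π → InfinitelyOften (Off t π)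
  marks-off π often N with often (suc N)
  ... | zero , () , _
  ... | suc k , s≤s N≤k , mark = k , N≤k , dec-sound em (trans (sym (marked-child (prefix π k) (π k))) mark)

no-antichain⇒accepted : EM → ∀ t → T-I t → Accepts M t
no-antichain⇒accepted em t no-antichain =
  ρ , run , Equivalence.from (accepting⇔ em ρ)
              (λ π often → no-antichain (offBranch-antichain t π (marks-off π often)))
  where open TruthfulRun em t

lemma3p3 : ExcludedMiddle 0ℓ → Regular T-I
lemma3p3 em = M , λ t → mk⇔ (no-antichain⇒accepted em t) (accepted⇒no-antichain em t)
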